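{- Let $s\ge1$, $m,n\ge1$, $N=m+n>s+2$ and $g\ge0$. Then the number of binary words of length $N$ with $m$ zeros and $n$ ones in which the string $0^{s+2}$ ($s+2$ zeros) occurs (cyclically) exactly $g$ times is $$\mathsf{T}^{mn}_{g}(0^{s+2})=\frac{N}{n}\sum_{h=1}^{\min(m,n)}c^{(s)mg}_{h}\binom{n}{h},$$ and the number of such words in which $1^{s+2}$ occurs exactly $g$ times is $$\mathsf{T}^{mn}_{g}(1^{s+2})=\frac{N}{m}\sum_{h=1}^{\min(m,n)}c^{(s)ng}_{h}\binom{m}{h}.$$
   Context: Occurrences are cyclic: for $S=\alpha_1\cdots\alpha_N$ and a word $U$ with $|U|<N$, count the $i\in\{1,\dots,N\}$ with $\alpha_i\cdots\alpha_{i+|U|-1}=U$, indices modulo $N$. Binomial coefficients $\binom ab$ are $0$ unless $0\le b\le a$. For $1\le h\le m$: if $g\ne0$, $c^{(s)mg}_{h}=\frac1g\sum_{k=1}^{g}\sum k\binom{h}{f_1}\binom{f_1}{f_2}\cdots\binom{f_{s-1}}{f_s}\binom{f_s}{k}\binom{g}{k}$, the inner sum over integers $h\ge f_1\ge\cdots\ge f_s\ge k$ with $f_1+\cdots+f_s=m-h-g$; and $c^{(s)m0}_{h}=\sum\binom{h}{f_1}\binom{f_1}{f_2}\cdots\binom{f_{s-1}}{f_s}$ over $h\ge f_1\ge\cdots\ge f_s\ge0$ with $f_1+\cdots+f_s=m-h$. (Equivalently, $c^{(s)mg}_h$ is the number of compositions $(a_1,\dots,a_h)$ of $m$ into $h$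 positive parts with $\sum_i\max(a_i-s-1,0)=g$.) -}

module Defs where

open import Data.Bool using (Bool; true; false; if_then_else_; _∧_; not)
open import Data.Nat using (ℕ; zero; suc; _+_; _*_; _∸_; _/_; _≡ᵇ_; _≤ᵇ_; _⊓_)
open import Data.Nat.Combinatorics using (_C_)
open import Data.List using (List; []; _∷_; _++_; length; drop; filterᵇ; map; replicate; concatMap)
open import Data.Vec using (Vec; []; _∷_; toList)

-- Bits: false = 0, true = 1.
bitEq : Bool → Bool → Bool
bitEq true true = true
bitEq false false = true
bitEq _ _ = false

-- Σ_{i=lo}^{hi} f i   (empty if hi < lo)
sumFromTo : ℕ → ℕ → (ℕ → ℕ) → ℕ
sumFromTo lo hi f = go (suc hi ∸ lo) lo
  where
  go : ℕ → ℕ → ℕ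
  go zero i = 0
  go (suc r) i = f i + go r (suc i)

isPrefix : List Bool → List Bool → Bool
isPrefix [] _ = true
isPrefix (u ∷ us) [] = false
isPrefix (u ∷ us) (x ∷ xs) = bitEq u x ∧ isPrefix us xs

-- cyclic occurrences of U in the word xs (valid reading for |U| < |xs|):
-- number of i ∈ {0,…,|xs|-1} such that xs_i … xs_{i+|U|-1} = U, indices mod |xs|
cycOcc : List Bool → List Bool → ℕ
cycOcc U xs = sumFromTo 0 (length xs ∸ 1)
  (λ i → if isPrefix U (drop i (xs ++ xs)) then 1 else 0)
-- (for xs = [] the sum has one term with i = 0; irrelevant since N ≥ 2 below)

countB : Bool → List Bool → ℕ
countB b xs = length (filterᵇ (bitEq b) xs)

allWords : (N : ℕ) → List (Vec Bool N)
allWords zero = [] ∷ []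
allWords (suc N) = concatMap (λ w → (false ∷ w) ∷ (true ∷ w) ∷ []) (allWords N)

Tcount : ℕ → ℕ → ℕ → List Bool → ℕ
Tcount m n g U = length (filterᵇ ok (allWords (m + n)))
  where
  ok : Vec Bool (m + n) → Bool
  ok w = (countB false (toList w) ≡ᵇ m) ∧ ((countB true (toList w) ≡ᵇ n)
         ∧ (cycOcc U (toList w) ≡ᵇ g))

-- chain r prev t w = Σ over prev ≥ f₁ ≥ … ≥ f_r ≥ 0 with f₁+…+f_r = t of
--   C(prev,f₁) C(f₁,f₂) … C(f_{r-1},f_r) · w(f_r)       (for r = 0: w(prev) if t = 0)
chain : ℕ → ℕ → ℕ → (ℕ → ℕ) → ℕ
chain zero prev t w = if t ≡ᵇ 0 then w prev else 0
chain (suc r) prev t w =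
  sumFromTo 0 prev (λ f → if f ≤ᵇ t then (prev C f) * chain r f (t ∸ f) w else 0)

-- c^{(s)mg}_h as defined in the paper (constraint f₁+…+f_s = m-h-g; empty if m < h+g).
-- Lower bound f_s ≥ k is enforced by C(f_s,k) = 0 for f_s < k.
-- For g ≠ 0 the division by g is exact (natural-number division).
coeffC : ℕ → ℕ → ℕ → ℕ → ℕ
coeffC s m zero h =
  if h ≤ᵇ m then chain s h (m ∸ h) (λ _ → 1) else 0
coeffC s m (suc g') h =
  (if (h + suc g') ≤ᵇ m
   then sumFromTo 1 (suc g') (λ k → k * chain s h (m ∸ h ∸ suc g') (λ fs → (fs C k) * (suc g' C k)))
   else 0) / suc g'

zeros ones : ℕ → List Bool
zeros r = replicate r false
ones r = replicate r true

-- Rotating a word so that it starts with a one, it splits into its n blocks 1 0^a, and a block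
-- with a zeros contains a ∸ (s+1) cyclic occurrences of 0^(s+2). Counting the words together with
-- a marked one in two ways therefore gives n · T = N · [x^m y^g] R_{s+1}^n, where
-- R_r = Σ_a x^a y^(a ∸ r). Since R_{r+1} = 1 + x R_r, the binomial theorem gives
-- R_{r+1}^n = Σ_h C(n,h) x^h R_r^h; unfolding this s times down to R_0 = 1/(1 − xy), whose powers have
-- multiset coefficients, produces the nested sums defining c^(s)mg_h (the division by g there is
-- undone by Σ_k k C(f,k) C(g,k) = g C(f+g−1,g)). The count for 1^(s+2) follows by complementing letters.
module Submission where

open import Data.Bool using (Bool; true; false; if_then_else_; _∧_; not)
open import Data.Bool.Properties using (T-≡; not-involutive)
open import Data.Fin using (toℕ)
open import Data.Fin.Properties using (toℕ<n; toℕ-inject₁; toℕ-fromℕ)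
open import Data.List using (List; []; _∷_; _++_; length; drop; filterᵇ; map; concatMap)
open import Data.List.Properties
  using (length-filter; filter-++; ++-assoc; ++-identityʳ; length-++; length-++-≤ˡ; length-replicate;
         map-replicate; map-++; length-map; drop-map)
open import Data.Nat
open import Data.Nat.Combinatorics using (_C_; nCk+nC[k+1]≡[n+1]C[k+1]; k>n⇒nCk≡0)
open import Data.Nat.DivMod using (m*n/n≡m)
open import Data.Nat.ListAction using () renaming (sum to sumᴸ)
open import Data.Nat.Properties
open import Algebra.Properties.CommutativeSemigroup *-commutativeSemigroup using (x∙yz≈y∙xz)
open import Algebra.Properties.CommutativeSemigroup +-commutativeSemigroup
  using () renaming (x∙yz≈y∙xz to x+[y+z]≡y+[x+z])
open import Algebra.Properties.Semiring.Sum +-*-semiring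
  using (sum; sum-cong-≗; ∑-distrib-+; ∑-comm; *-distribˡ-sum; sum-init-last; sum-replicate-zero)
open import Data.Nat.Tactic.RingSolver using (solve-∀)
open import Data.Product using (_×_; _,_)
open import Data.Sum using (inj₁; inj₂)
open import Data.Vec using (toList) renaming (_∷_ to _∷ᵥ_)
open import Function using (_∘_)
open import Function.Bundles using (Equivalence)
open import Relation.Binary.PropositionalEquality hiding ([_])
open import Relation.Nullary using (yes; no; contradiction)
open import Relation.Nullary.Decidable using (dec-true; dec-false; T?)

open import Defs

∑ℕ : ℕ → (ℕ → ℕ) → ℕ
∑ℕ r f = sum {r} (f ∘ toℕ)

syntax ∑ℕ r (λ i → x) = ∑ℕ[ i < r ] x

∑ℕ-cong-< : ∀ r {f g : ℕ → ℕ} → (∀ i → i < r → f i ≡ g i) → ∑ℕ r f ≡ ∑ℕ r g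
∑ℕ-cong-< r e = sum-cong-≗ {r} (λ i → e (toℕ i) (toℕ<n i))

∑ℕ-cong : ∀ r {f g : ℕ → ℕ} → (∀ i → f i ≡ g i) → ∑ℕ r f ≡ ∑ℕ r g
∑ℕ-cong r e = ∑ℕ-cong-< r (λ i _ → e i)

∑ℕ-zero : ∀ r {f : ℕ → ℕ} → (∀ i → f i ≡ 0) → ∑ℕ r f ≡ 0
∑ℕ-zero r e = trans (∑ℕ-cong r e) (sum-replicate-zero r)

∑ℕ-+ : ∀ r (f g : ℕ → ℕ) → ∑ℕ[ i < r ] (f i + g i) ≡ ∑ℕ r f + ∑ℕ r g
∑ℕ-+ r f g = ∑-distrib-+ {r} (f ∘ toℕ) (g ∘ toℕ)

*-distribˡ-∑ℕ : ∀ r c (f : ℕ → ℕ) → c * ∑ℕ r f ≡ ∑ℕ[ i < r ] (c * f i)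
*-distribˡ-∑ℕ r c f = *-distribˡ-sum {r} c (f ∘ toℕ)

*-distribˡ-∑ℕ-weighted : ∀ r x (c y : ℕ → ℕ) → x * ∑ℕ[ h < r ] (c h * y h) ≡ ∑ℕ[ h < r ] (c h * (x * y h))
*-distribˡ-∑ℕ-weighted r x c y =
  trans (*-distribˡ-∑ℕ r x (λ h → c h * y h)) (∑ℕ-cong r λ h → x∙yz≈y∙xz x (c h) (y h))

∑ℕ-comm : ∀ a b (f : ℕ → ℕ → ℕ) → ∑ℕ[ i < a ] ∑ℕ[ j < b ] f i j ≡ ∑ℕ[ j < b ] ∑ℕ[ i < a ] f i j
∑ℕ-comm a b f = ∑-comm {a} {b} (λ i j → f (toℕ i) (toℕ j))

∑ℕ-last : ∀ r (f : ℕ → ℕ) → ∑ℕ (suc r) f ≡ ∑ℕ r f + f r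
∑ℕ-last r f = trans (sum-init-last {r} (f ∘ toℕ))
  (cong₂ _+_ (sum-cong-≗ {r} (cong f ∘ toℕ-inject₁)) (cong f (toℕ-fromℕ r)))

∑ℕ-const : ∀ r c → ∑ℕ[ _ < r ] c ≡ r * c
∑ℕ-const zero c = refl
∑ℕ-const (suc r) c = cong (c +_) (∑ℕ-const r c)

∑ℕ-truncate : ∀ k r (f : ℕ → ℕ) → k ≤ r → (∀ i → k ≤ i → i < r → f i ≡ 0) → ∑ℕ r f ≡ ∑ℕ k f
∑ℕ-truncate zero r f _ vanish = trans (∑ℕ-cong-< r (λ i i<r → vanish i z≤n i<r)) (sum-replicate-zero r)
∑ℕ-truncate (suc k) (suc r) f (s≤s k≤r) vanish =
  cong (f 0 +_) (∑ℕ-truncate k r (f ∘ suc) k≤r (λ i k≤i i<r → vanish (suc i) (s≤s k≤i) (s≤s i<r)))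

∑ℕ-shift-periodic : ∀ r (f : ℕ → ℕ) → f r ≡ f 0 → ∑ℕ[ i < r ] f (suc i) ≡ ∑ℕ r f
∑ℕ-shift-periodic r f fr≡f0 = +-cancelˡ-≡ (f 0) _ _ (begin
  f 0 + ∑ℕ[ i < r ] f (suc i)   ≡⟨ ∑ℕ-last r f ⟩
  ∑ℕ r f + f r                  ≡⟨ cong (∑ℕ r f +_) fr≡f0 ⟩
  ∑ℕ r f + f 0                  ≡⟨ +-comm (∑ℕ r f) (f 0) ⟩
  f 0 + ∑ℕ r f                  ∎)
  where open ≡-Reasoning

sumFromTo-unfold : ∀ f lo hi → lo ≤ hi → sumFromTo lo hi f ≡ f lo + sumFromTo (suc lo) hi f
sumFromTo-unfold f lo hi lo≤hi rewrite +-∸-assoc 1 lo≤hi = refl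

sumFromTo-∑ℕ : ∀ f lo hi → sumFromTo lo hi f ≡ ∑ℕ[ i < suc hi ∸ lo ] f (lo + i)
sumFromTo-∑ℕ f lo hi = go (suc hi ∸ lo) lo refl
  where
  go : ∀ r lo → suc hi ∸ lo ≡ r → sumFromTo lo hi f ≡ ∑ℕ[ i < r ] f (lo + i)
  go zero lo eq rewrite eq = refl
  go (suc r) lo eq with lo ≤? hi
  ... | no lo≰hi with () ← trans (sym eq) (m≤n⇒m∸n≡0 (≰⇒> lo≰hi))
  ... | yes lo≤hi = begin
    sumFromTo lo hi f                          ≡⟨ sumFromTo-unfold f lo hi lo≤hi ⟩
    f lo + sumFromTo (suc lo) hi f             ≡⟨ cong₂ _+_ (cong f (sym (+-identityʳ lo))) (go r (suc lo) eq′) ⟩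
    f (lo + 0) + ∑ℕ[ i < r ] f (suc lo + i)    ≡⟨ cong (f (lo + 0) +_) (∑ℕ-cong r (λ i → cong f (sym (+-suc lo i)))) ⟩
    ∑ℕ[ i < suc r ] f (lo + i)                 ∎
    where
    open ≡-Reasoning
    eq′ : suc hi ∸ suc lo ≡ r
    eq′ = suc-injective (trans (sym (+-∸-assoc 1 lo≤hi)) eq)

[_] : Bool → ℕ
[ b ] = if b then 1 else 0

if-then-else-0 : ∀ b n → (if b then n else 0) ≡ [ b ] * n
if-then-else-0 true n = sym (+-identityʳ n)
if-then-else-0 false n = refl

[]-∧ : ∀ a b → [ a ∧ b ] ≡ [ a ] * [ b ]
[]-∧ true b = sym (+-identityʳ [ b ])
[]-∧ false b = refl

≤ᵇ-suc : ∀ a b → (suc a ≤ᵇ suc b) ≡ (a ≤ᵇ b)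
≤ᵇ-suc zero b = refl
≤ᵇ-suc (suc a) b = refl

≡ᵇ-via-≤ᵇ : ∀ a j → (a ≡ᵇ j) ≡ (j ≤ᵇ a) ∧ (a ∸ j ≡ᵇ 0)
≡ᵇ-via-≤ᵇ zero zero = refl
≡ᵇ-via-≤ᵇ zero (suc j) = refl
≡ᵇ-via-≤ᵇ (suc a) zero = refl
≡ᵇ-via-≤ᵇ (suc a) (suc j) rewrite ≤ᵇ-suc j a = ≡ᵇ-via-≤ᵇ a j

≤ᵇ-∧-∸ : ∀ f j a → (f ≤ᵇ a) ∧ (j ≤ᵇ a ∸ f) ≡ (f + j ≤ᵇ a)
≤ᵇ-∧-∸ zero j a = refl
≤ᵇ-∧-∸ (suc f) j zero = refl
≤ᵇ-∧-∸ (suc f) j (suc a) rewrite ≤ᵇ-suc f a | ≤ᵇ-suc (f + j) a = ≤ᵇ-∧-∸ f j a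

[≤ᵇ]-∸-comm : ∀ f j a → [ f ≤ᵇ a ] * [ j ≤ᵇ a ∸ f ] ≡ [ j ≤ᵇ a ] * [ f ≤ᵇ a ∸ j ]
[≤ᵇ]-∸-comm f j a = begin
  [ f ≤ᵇ a ] * [ j ≤ᵇ a ∸ f ]   ≡⟨ sym ([]-∧ (f ≤ᵇ a) _) ⟩
  [ (f ≤ᵇ a) ∧ (j ≤ᵇ a ∸ f) ]   ≡⟨ cong [_] (≤ᵇ-∧-∸ f j a) ⟩
  [ f + j ≤ᵇ a ]                ≡⟨ cong (λ n → [ n ≤ᵇ a ]) (+-comm f j) ⟩
  [ j + f ≤ᵇ a ]                ≡⟨ cong [_] (sym (≤ᵇ-∧-∸ j f a)) ⟩
  [ (j ≤ᵇ a) ∧ (f ≤ᵇ a ∸ j) ]   ≡⟨ []-∧ (j ≤ᵇ a) _ ⟩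
  [ j ≤ᵇ a ] * [ f ≤ᵇ a ∸ j ]   ∎
  where open ≡-Reasoning

∸-∸-comm : ∀ a f j → a ∸ f ∸ j ≡ a ∸ j ∸ f
∸-∸-comm a f j = trans (∸-+-assoc a f j) (trans (cong (a ∸_) (+-comm f j)) (sym (∸-+-assoc a j f)))

[≤ᵇ]+∸ : ∀ k c → [ suc k ≤ᵇ c ] + (c ∸ suc k) ≡ c ∸ k
[≤ᵇ]+∸ k zero = sym (0∸n≡0 k)
[≤ᵇ]+∸ zero (suc c) = refl
[≤ᵇ]+∸ (suc k) (suc c) = trans (cong (λ b → [ b ] + (c ∸ suc k)) (≤ᵇ-suc (suc k) c)) ([≤ᵇ]+∸ k c)

[+≡ᵇ] : ∀ e r g → [ e + r ≡ᵇ g ] ≡ [ e ≤ᵇ g ] * [ r ≡ᵇ g ∸ e ]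
[+≡ᵇ] zero r g = sym (+-identityʳ _)
[+≡ᵇ] (suc e) r zero = refl
[+≡ᵇ] (suc e) r (suc g) rewrite ≤ᵇ-suc e g = [+≡ᵇ] e r g

[∧-implied] : ∀ a b c → (a ≡ true → b ≡ true) → [ a ∧ (b ∧ c) ] ≡ [ a ] * [ c ]
[∧-implied] false b c _ = refl
[∧-implied] true b c a⇒b rewrite a⇒b refl = sym (+-identityʳ [ c ])

*-[∧≡ᵇ∧] : ∀ a c n d → n * [ a ∧ ((c ≡ᵇ n) ∧ d) ] ≡ c * [ a ∧ ((c ≡ᵇ n) ∧ d) ]
*-[∧≡ᵇ∧] false c n d = trans (*-zeroʳ n) (sym (*-zeroʳ c))
*-[∧≡ᵇ∧] true c n d with c ≡ᵇ n in c≡ᵇn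
... | true = cong (_* [ d ]) (sym (≡ᵇ⇒≡ c n (Equivalence.from T-≡ c≡ᵇn)))
... | false = trans (*-zeroʳ n) (sym (*-zeroʳ c))

∑ℕ-[≡ᵇ] : ∀ j e (F : ℕ → ℕ) → ∑ℕ[ k < suc j ] ([ k ≡ᵇ e ] * F k) ≡ [ e ≤ᵇ j ] * F e
∑ℕ-[≡ᵇ] zero zero F = +-identityʳ _
∑ℕ-[≡ᵇ] zero (suc e) F = refl
∑ℕ-[≡ᵇ] (suc j) zero F = trans (cong (1 * F 0 +_) (∑ℕ-zero (suc j) λ _ → refl)) (+-identityʳ _)
∑ℕ-[≡ᵇ] (suc j) (suc e) F rewrite ≤ᵇ-suc e j = ∑ℕ-[≡ᵇ] j e (F ∘ suc)

⊓-≤-<⇒≤ : ∀ m n i → m ⊓ n ≤ i → i < n → m ≤ i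
⊓-≤-<⇒≤ m n i m⊓n≤i i<n with ≤-total m n
... | inj₁ m≤n = subst (_≤ i) (m≤n⇒m⊓n≡m m≤n) m⊓n≤i
... | inj₂ n≤m = contradiction (subst (_≤ i) (m≥n⇒m⊓n≡n n≤m) m⊓n≤i) (<⇒≱ i<n)

-- Binomial identities

multichoose : ℕ → ℕ → ℕ
multichoose f g = (f + g ∸ 1) C g

multichoose-pascal : ∀ f g → multichoose f (suc g) + multichoose (suc f) g ≡ multichoose (suc f) (suc g)
multichoose-pascal f g = begin
  (f + suc g ∸ 1) C suc g + (f + g) C g   ≡⟨ cong (λ n → (n ∸ 1) C suc g + (f + g) C g) (+-suc f g) ⟩
  (f + g) C suc g + (f + g) C g           ≡⟨ +-comm ((f + g) C suc g) _ ⟩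
  (f + g) C g + (f + g) C suc g           ≡⟨ nCk+nC[k+1]≡[n+1]C[k+1] (f + g) g ⟩
  suc (f + g) C suc g                     ≡⟨ cong (λ n → (n ∸ 1) C suc g) (sym (+-suc (suc f) g)) ⟩
  (suc f + suc g ∸ 1) C suc g             ∎
  where open ≡-Reasoning

∑ℕ-pascal : ∀ n (x : ℕ → ℕ) →
  ∑ℕ[ h < suc n ] ((n C h) * x h) + ∑ℕ[ h < suc n ] ((n C h) * x (suc h)) ≡ ∑ℕ[ h < suc (suc n) ] ((suc n C h) * x h)
∑ℕ-pascal n x = begin
  (1 * x 0 + B) + A
    ≡⟨ rearrange (1 * x 0) B A ⟩
  1 * x 0 + (A + (B + 0))
    ≡⟨ cong (λ t → 1 * x 0 + (A + t)) (sym B′≡B+0) ⟩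
  1 * x 0 + (A + B′)
    ≡⟨ cong (1 * x 0 +_) (sym (∑ℕ-+ (suc n) (λ h → (n C h) * x (suc h)) (λ h → (n C suc h) * x (suc h)))) ⟩
  1 * x 0 + ∑ℕ[ h < suc n ] ((n C h) * x (suc h) + (n C suc h) * x (suc h))
    ≡⟨ cong (1 * x 0 +_) (∑ℕ-cong (suc n) λ h →
         trans (sym (*-distribʳ-+ (x (suc h)) (n C h) (n C suc h))) (cong (_* x (suc h)) (nCk+nC[k+1]≡[n+1]C[k+1] n h))) ⟩
  ∑ℕ[ h < suc (suc n) ] ((suc n C h) * x h) ∎
  where
  open ≡-Reasoning
  A B B′ : ℕ
  A = ∑ℕ[ h < suc n ] ((n C h) * x (suc h))
  B = ∑ℕ[ h < n ] ((n C suc h) * x (suc h))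
  B′ = ∑ℕ[ h < suc n ] ((n C suc h) * x (suc h))
  B′≡B+0 : B′ ≡ B + 0
  B′≡B+0 = trans (∑ℕ-last n (λ h → (n C suc h) * x (suc h))) (cong (λ t → B + t * x (suc n)) (k>n⇒nCk≡0 (n<1+n n)))
  rearrange : ∀ a b c → (a + b) + c ≡ a + (c + (b + 0))
  rearrange = solve-∀

vandermonde : ∀ g d f → ∑ℕ[ k < suc g ] ((f C (d + k)) * (g C k)) ≡ (f + g) C (d + g)
vandermonde zero d f rewrite +-identityʳ f | +-identityʳ d = trans (+-identityʳ _) (*-identityʳ _)
vandermonde (suc g) d f = begin
  c₀ + ∑ℕ[ k < suc g ] ((f C (d + suc k)) * (suc g C suc k))
    ≡⟨ cong (c₀ +_) (∑ℕ-cong (suc g) λ k →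
         trans (cong ((f C (d + suc k)) *_) (sym (nCk+nC[k+1]≡[n+1]C[k+1] g k))) (*-distribˡ-+ (f C (d + suc k)) (g C k) (g C suc k))) ⟩
  c₀ + ∑ℕ[ k < suc g ] (A k + B k)
    ≡⟨ cong (c₀ +_) (∑ℕ-+ (suc g) A B) ⟩
  c₀ + (∑ℕ (suc g) A + ∑ℕ (suc g) B)
    ≡⟨ x+[y+z]≡y+[x+z] c₀ (∑ℕ (suc g) A) (∑ℕ (suc g) B) ⟩
  ∑ℕ (suc g) A + (c₀ + ∑ℕ (suc g) B)
    ≡⟨ cong₂ _+_ shifted unshifted ⟩
  (f + g) C suc (d + g) + (f + g) C (d + g)
    ≡⟨ +-comm ((f + g) C suc (d + g)) _ ⟩
  (f + g) C (d + g) + (f + g) C suc (d + g)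
    ≡⟨ nCk+nC[k+1]≡[n+1]C[k+1] (f + g) (d + g) ⟩
  suc (f + g) C suc (d + g)
    ≡⟨ sym (cong₂ _C_ (+-suc f g) (+-suc d g)) ⟩
  (f + suc g) C (d + suc g) ∎
  where
  open ≡-Reasoning
  c₀ : ℕ
  c₀ = (f C (d + 0)) * 1
  A B : ℕ → ℕ
  A k = (f C (d + suc k)) * (g C k)
  B k = (f C (d + suc k)) * (g C suc k)
  shifted : ∑ℕ (suc g) A ≡ (f + g) C suc (d + g)
  shifted = trans (∑ℕ-cong (suc g) λ k → cong (λ i → (f C i) * (g C k)) (+-suc d k)) (vandermonde g (suc d) f)
  unshifted : c₀ + ∑ℕ (suc g) B ≡ (f + g) C (d + g)
  unshifted = begin
    ∑ℕ[ k < suc (suc g) ] ((f C (d + k)) * (g C k))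
      ≡⟨ ∑ℕ-last (suc g) (λ k → (f C (d + k)) * (g C k)) ⟩
    ∑ℕ[ k < suc g ] ((f C (d + k)) * (g C k)) + (f C (d + suc g)) * (g C suc g)
      ≡⟨ cong₂ _+_ (vandermonde g d f) (trans (cong ((f C (d + suc g)) *_) (k>n⇒nCk≡0 (n<1+n g))) (*-zeroʳ (f C (d + suc g)))) ⟩
    (f + g) C (d + g) + 0
      ≡⟨ +-identityʳ _ ⟩
    (f + g) C (d + g) ∎

absorption : ∀ n k → suc k * (suc n C suc k) ≡ suc n * (n C k)
absorption zero zero = refl
absorption zero (suc k) = *-zeroʳ (suc (suc k))
absorption (suc n) k = begin
  suc k * (suc (suc n) C suc k)
    ≡⟨ cong (suc k *_) (sym (nCk+nC[k+1]≡[n+1]C[k+1] (suc n) k)) ⟩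
  suc k * ((suc n C k) + (suc n C suc k))
    ≡⟨ *-distribˡ-+ (suc k) (suc n C k) _ ⟩
  suc k * (suc n C k) + suc k * (suc n C suc k)
    ≡⟨ cong (suc k * (suc n C k) +_) (absorption n k) ⟩
  (suc n C k) + k * (suc n C k) + suc n * (n C k)
    ≡⟨ +-assoc (suc n C k) _ _ ⟩
  (suc n C k) + (k * (suc n C k) + suc n * (n C k))
    ≡⟨ cong ((suc n C k) +_) (lower k) ⟩
  (suc n C k) + suc n * (suc n C k) ∎
  where
  open ≡-Reasoning
  lower : ∀ k → k * (suc n C k) + suc n * (n C k) ≡ suc n * (suc n C k)
  lower zero = refl
  lower (suc k) = begin
    suc k * (suc n C suc k) + suc n * (n C suc k)    ≡⟨ cong (_+ suc n * (n C suc k)) (absorption n k) ⟩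
    suc n * (n C k) + suc n * (n C suc k)            ≡⟨ sym (*-distribˡ-+ (suc n) (n C k) _) ⟩
    suc n * ((n C k) + (n C suc k))                  ≡⟨ cong (suc n *_) (nCk+nC[k+1]≡[n+1]C[k+1] n k) ⟩
    suc n * (suc n C suc k)                          ∎

∑-weighted-vandermonde : ∀ f g →
  ∑ℕ[ k < suc g ] (suc k * ((f C suc k) * (suc g C suc k))) ≡ suc g * multichoose f (suc g)
∑-weighted-vandermonde f g = begin
  ∑ℕ[ k < suc g ] (suc k * ((f C suc k) * (suc g C suc k)))
    ≡⟨ ∑ℕ-cong (suc g) (λ k → trans (x∙yz≈y∙xz (suc k) (f C suc k) _)
                                    (trans (cong ((f C suc k) *_) (absorption g k)) (x∙yz≈y∙xz (f C suc k) (suc g) _))) ⟩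
  ∑ℕ[ k < suc g ] (suc g * ((f C suc k) * (g C k)))
    ≡⟨ sym (*-distribˡ-∑ℕ (suc g) (suc g) λ k → (f C suc k) * (g C k)) ⟩
  suc g * ∑ℕ[ k < suc g ] ((f C suc k) * (g C k))
    ≡⟨ cong (suc g *_) (vandermonde g 1 f) ⟩
  suc g * ((f + g) C suc g)
    ≡⟨ cong (λ n → suc g * ((n ∸ 1) C suc g)) (sym (+-suc f g)) ⟩
  suc g * multichoose f (suc g) ∎
  where open ≡-Reasoning

-- Bivariate power series

-- F a j is the coefficient of xᵃ yʲ.
Series : Set
Series = ℕ → ℕ → ℕ

infix 4 _≈_
_≈_ : Series → Series → Set
F ≈ H = ∀ a j → F a j ≡ H a j

infixl 7 _⋆_
_⋆_ : Series → Series → Series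
(F ⋆ H) a j = ∑ℕ[ i < suc a ] ∑ℕ[ k < suc j ] (F i k * H (a ∸ i) (j ∸ k))

𝟙 : Series
𝟙 zero zero = 1
𝟙 zero (suc _) = 0
𝟙 (suc _) _ = 0

power : Series → ℕ → Series
power F zero = 𝟙
power F (suc n) = F ⋆ power F n

mulX : Series → Series
mulX H zero j = 0
mulX H (suc a) j = H a j

mulX^ : ℕ → Series → Series
mulX^ zero H = H
mulX^ (suc h) H = mulX (mulX^ h H)

-- (F − F(0, y)) / x
tailX : Series → Series
tailX F a = F (suc a)

mulY : Series → Series
mulY H a zero = 0
mulY H a (suc j) = H a j

mulX^-apply : ∀ h H a j → mulX^ h H a j ≡ [ h ≤ᵇ a ] * H (a ∸ h) j
mulX^-apply zero H a j = sym (+-identityʳ (H a j))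
mulX^-apply (suc h) H zero j = refl
mulX^-apply (suc h) H (suc a) j rewrite ≤ᵇ-suc h a = mulX^-apply h H a j

⋆-congˡ : ∀ F {H H′} → H ≈ H′ → F ⋆ H ≈ F ⋆ H′
⋆-congˡ F e a j = ∑ℕ-cong (suc a) λ i → ∑ℕ-cong (suc j) λ k → cong (F i k *_) (e (a ∸ i) (j ∸ k))

⋆-congʳ : ∀ {F F′} H → F ≈ F′ → F ⋆ H ≈ F′ ⋆ H
⋆-congʳ H e a j = ∑ℕ-cong (suc a) λ i → ∑ℕ-cong (suc j) λ k → cong (_* H (a ∸ i) (j ∸ k)) (e i k)

⋆-distribˡ-∑ℕ : ∀ F r (c : ℕ → ℕ) (G : ℕ → Series) →
  F ⋆ (λ a j → ∑ℕ[ h < r ] (c h * G h a j)) ≈ λ a j → ∑ℕ[ h < r ] (c h * (F ⋆ G h) a j)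
⋆-distribˡ-∑ℕ F r c G a j = begin
  ∑ℕ[ i < suc a ] ∑ℕ[ k < suc j ] (F i k * ∑ℕ[ h < r ] (c h * G h (a ∸ i) (j ∸ k)))
    ≡⟨ ∑ℕ-cong (suc a) (λ i → ∑ℕ-cong (suc j) λ k →
         *-distribˡ-∑ℕ-weighted r (F i k) c (λ h → G h (a ∸ i) (j ∸ k))) ⟩
  ∑ℕ[ i < suc a ] ∑ℕ[ k < suc j ] ∑ℕ[ h < r ] term i k h
    ≡⟨ ∑ℕ-cong (suc a) (λ i → ∑ℕ-comm (suc j) r (term i)) ⟩
  ∑ℕ[ i < suc a ] ∑ℕ[ h < r ] ∑ℕ[ k < suc j ] term i k h
    ≡⟨ ∑ℕ-comm (suc a) r (λ i h → ∑ℕ[ k < suc j ] term i k h) ⟩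
  ∑ℕ[ h < r ] ∑ℕ[ i < suc a ] ∑ℕ[ k < suc j ] term i k h
    ≡⟨ ∑ℕ-cong r (λ h → trans (∑ℕ-cong (suc a) λ i → sym (*-distribˡ-∑ℕ (suc j) (c h) (λ k → F i k * G h (a ∸ i) (j ∸ k))))
                                (sym (*-distribˡ-∑ℕ (suc a) (c h) (λ i → ∑ℕ[ k < suc j ] (F i k * G h (a ∸ i) (j ∸ k)))))) ⟩
  ∑ℕ[ h < r ] (c h * (F ⋆ G h) a j) ∎
  where
  open ≡-Reasoning
  term : ℕ → ℕ → ℕ → ℕ
  term i k h = c h * (F i k * G h (a ∸ i) (j ∸ k))

⋆-mulXˡ : ∀ F H → F ⋆ mulX H ≈ mulX (F ⋆ H)
⋆-mulXˡ F H zero j = trans (+-identityʳ _) (∑ℕ-zero (suc j) λ k → *-zeroʳ (F 0 k))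
⋆-mulXˡ F H (suc a) j = begin
  ∑ℕ[ i < suc (suc a) ] row i                    ≡⟨ ∑ℕ-last (suc a) row ⟩
  ∑ℕ[ i < suc a ] row i + row (suc a)            ≡⟨ cong₂ _+_ (∑ℕ-cong-< (suc a) λ i i<1+a →
                                                      cong (λ b → ∑ℕ[ k < suc j ] (F i k * mulX H b (j ∸ k))) (+-∸-assoc 1 (s≤s⁻¹ i<1+a)))
                                                      (∑ℕ-zero (suc j) λ k → cong (λ b → F (suc a) k * mulX H b (j ∸ k)) (n∸n≡0 a) ∙ *-zeroʳ (F (suc a) k)) ⟩
  (F ⋆ H) a j + 0                                ≡⟨ +-identityʳ _ ⟩
  (F ⋆ H) a j                                    ∎
  where
  open ≡-Reasoning
  _∙_ = trans
  row : ℕ → ℕ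
  row i = ∑ℕ[ k < suc j ] (F i k * mulX H (suc a ∸ i) (j ∸ k))

⋆-mulX^ˡ : ∀ h F H → F ⋆ mulX^ h H ≈ mulX^ h (F ⋆ H)
⋆-mulX^ˡ zero F H a j = refl
⋆-mulX^ˡ (suc h) F H zero j = ⋆-mulXˡ F (mulX^ h H) zero j
⋆-mulX^ˡ (suc h) F H (suc a) j = trans (⋆-mulXˡ F (mulX^ h H) (suc a) j) (⋆-mulX^ˡ h F H a j)

⋆-mulYʳ-zero : ∀ F H a → (mulY F ⋆ H) a 0 ≡ 0
⋆-mulYʳ-zero F H a = ∑ℕ-zero (suc a) λ _ → refl

∑ℕ-𝟙 : ∀ j (f : ℕ → ℕ) (h : ℕ → ℕ) → (∀ k → f k ≡ 𝟙 0 k) → ∑ℕ[ k < suc j ] (f k * h (j ∸ k)) ≡ h j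
∑ℕ-𝟙 j f h f≡𝟙 = begin
  f 0 * h j + ∑ℕ[ k < j ] (f (suc k) * h (j ∸ suc k))
    ≡⟨ cong₂ _+_ (cong (_* h j) (f≡𝟙 0)) (∑ℕ-zero j λ k → cong (_* h (j ∸ suc k)) (f≡𝟙 (suc k))) ⟩
  1 * h j + 0
    ≡⟨ trans (+-identityʳ _) (*-identityˡ (h j)) ⟩
  h j ∎
  where open ≡-Reasoning

⋆-unfold : ∀ F H → (∀ k → F 0 k ≡ 𝟙 0 k) → F ⋆ H ≈ λ a j → H a j + mulX (tailX F ⋆ H) a j
⋆-unfold F H F₀≡𝟙 zero j = cong (_+ 0) (∑ℕ-𝟙 j (F 0) (H 0) F₀≡𝟙)
⋆-unfold F H F₀≡𝟙 (suc a) j = cong (_+ (tailX F ⋆ H) a j) (∑ℕ-𝟙 j (F 0) (H (suc a)) F₀≡𝟙)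

binomial-⋆ : ∀ F → (∀ k → F 0 k ≡ 𝟙 0 k) → ∀ n →
  power F n ≈ λ a j → ∑ℕ[ h < suc n ] ((n C h) * mulX^ h (power (tailX F) h) a j)
binomial-⋆ F F₀≡𝟙 zero a j = sym (trans (+-identityʳ _) (+-identityʳ _))
binomial-⋆ F F₀≡𝟙 (suc n) a j = begin
  (F ⋆ power F n) a j                          ≡⟨ ⋆-congˡ F (binomial-⋆ F F₀≡𝟙 n) a j ⟩
  (F ⋆ S) a j                                  ≡⟨ ⋆-unfold F S F₀≡𝟙 a j ⟩
  S a j + mulX (G ⋆ S) a j                     ≡⟨ cong (S a j +_) (shifted a) ⟩
  S a j + ∑ℕ[ h < suc n ] ((n C h) * term (suc h))  ≡⟨ ∑ℕ-pascal n term ⟩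
  ∑ℕ[ h < suc (suc n) ] ((suc n C h) * term h) ∎
  where
  open ≡-Reasoning
  G : Series
  G = tailX F
  S : Series
  S a j = ∑ℕ[ h < suc n ] ((n C h) * mulX^ h (power G h) a j)
  term : ℕ → ℕ
  term h = mulX^ h (power G h) a j
  shifted : ∀ a → mulX (G ⋆ S) a j ≡ ∑ℕ[ h < suc n ] ((n C h) * mulX^ (suc h) (power G (suc h)) a j)
  shifted zero = sym (∑ℕ-zero (suc n) λ h → *-zeroʳ (n C h))
  shifted (suc a) = trans (⋆-distribˡ-∑ℕ G (suc n) (n C_) (λ h → mulX^ h (power G h)) a j)
    (∑ℕ-cong (suc n) λ h → cong ((n C h) *_) (⋆-mulX^ˡ h G (power G h) a j))

[≡ᵇ]-𝟙 : ∀ e g → [ e ≡ᵇ g ] ≡ [ e ≤ᵇ g ] * 𝟙 0 (g ∸ e)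
[≡ᵇ]-𝟙 zero zero = refl
[≡ᵇ]-𝟙 zero (suc g) = refl
[≡ᵇ]-𝟙 (suc e) zero = refl
[≡ᵇ]-𝟙 (suc e) (suc g) rewrite ≤ᵇ-suc e g = [≡ᵇ]-𝟙 e g

-- The series R_r and the coefficients c^(s)mg_h

-- R_r = Σ_a x^a y^(a ∸ r); in R_{s+1} the exponent of y counts the occurrences of 0^(s+2) in a run of a zeros.
run : ℕ → Series
run r a j = [ j ≡ᵇ a ∸ r ]

power-run-binomial : ∀ r n →
  power (run (suc r)) n ≈ λ a j → ∑ℕ[ h < suc n ] ((n C h) * mulX^ h (power (run r) h) a j)
power-run-binomial r = binomial-⋆ (run (suc r)) λ { zero → refl ; (suc k) → refl }

-- R_0 = 1/(1 − xy)
power-run0 : ∀ h a j → power (run 0) h a j ≡ [ a ≡ᵇ j ] * multichoose h j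
power-run0 zero zero zero = refl
power-run0 zero zero (suc j) = refl
power-run0 zero (suc a) zero = refl
power-run0 zero (suc a) (suc j) = sym (trans (cong ([ a ≡ᵇ j ] *_) (k>n⇒nCk≡0 (n<1+n j))) (*-zeroʳ [ a ≡ᵇ j ]))
power-run0 (suc h) a j = trans (⋆-unfold (run 0) (power (run 0) h) (λ { zero → refl ; (suc k) → refl }) a j) (step a j)
  where
  step : ∀ a j → power (run 0) h a j + mulX (mulY (run 0) ⋆ power (run 0) h) a j ≡ [ a ≡ᵇ j ] * multichoose (suc h) j
  step zero zero = trans (+-identityʳ _) (power-run0 h 0 0)
  step zero (suc j) = trans (+-identityʳ _) (power-run0 h 0 (suc j))
  step (suc a) zero = cong₂ _+_ (power-run0 h (suc a) 0) (⋆-mulYʳ-zero (run 0) (power (run 0) h) a)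
  step (suc a) (suc j) = begin
    power (run 0) h (suc a) (suc j) + power (run 0) (suc h) a j
      ≡⟨ cong₂ _+_ (power-run0 h (suc a) (suc j)) (power-run0 (suc h) a j) ⟩
    [ a ≡ᵇ j ] * multichoose h (suc j) + [ a ≡ᵇ j ] * multichoose (suc h) j
      ≡⟨ sym (*-distribˡ-+ [ a ≡ᵇ j ] _ _) ⟩
    [ a ≡ᵇ j ] * (multichoose h (suc j) + multichoose (suc h) j)
      ≡⟨ cong ([ a ≡ᵇ j ] *_) (multichoose-pascal h j) ⟩
    [ a ≡ᵇ j ] * multichoose (suc h) (suc j) ∎
    where open ≡-Reasoning

chain-suc : ∀ r p t w → chain (suc r) p t w ≡ ∑ℕ[ f < suc p ] ([ f ≤ᵇ t ] * ((p C f) * chain r f (t ∸ f) w))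
chain-suc r p t w = trans (sumFromTo-∑ℕ _ 0 p) (∑ℕ-cong (suc p) λ f → if-then-else-0 (f ≤ᵇ t) ((p C f) * chain r f (t ∸ f) w))

power-run-chain : ∀ r h a j → power (run r) h a j ≡ [ j ≤ᵇ a ] * chain r h (a ∸ j) (λ f → multichoose f j)
power-run-chain zero h a j = begin
  power (run 0) h a j                                      ≡⟨ power-run0 h a j ⟩
  [ a ≡ᵇ j ] * multichoose h j                             ≡⟨ cong (λ b → [ b ] * multichoose h j) (≡ᵇ-via-≤ᵇ a j) ⟩
  [ (j ≤ᵇ a) ∧ (a ∸ j ≡ᵇ 0) ] * multichoose h j            ≡⟨ cong (_* multichoose h j) ([]-∧ (j ≤ᵇ a) _) ⟩
  [ j ≤ᵇ a ] * [ a ∸ j ≡ᵇ 0 ] * multichoose h j            ≡⟨ *-assoc [ j ≤ᵇ a ] _ _ ⟩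
  [ j ≤ᵇ a ] * ([ a ∸ j ≡ᵇ 0 ] * multichoose h j)          ≡⟨ cong ([ j ≤ᵇ a ] *_) (sym (if-then-else-0 (a ∸ j ≡ᵇ 0) _)) ⟩
  [ j ≤ᵇ a ] * chain 0 h (a ∸ j) (λ f → multichoose f j)           ∎
  where open ≡-Reasoning
power-run-chain (suc r) h a j = begin
  power (run (suc r)) h a j
    ≡⟨ power-run-binomial r h a j ⟩
  ∑ℕ[ f < suc h ] ((h C f) * mulX^ f (power (run r) f) a j)
    ≡⟨ ∑ℕ-cong (suc h) term ⟩
  ∑ℕ[ f < suc h ] ([ j ≤ᵇ a ] * summand f)
    ≡⟨ sym (*-distribˡ-∑ℕ (suc h) [ j ≤ᵇ a ] summand) ⟩
  [ j ≤ᵇ a ] * ∑ℕ[ f < suc h ] summand f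
    ≡⟨ cong ([ j ≤ᵇ a ] *_) (sym (chain-suc r h (a ∸ j) (λ f → multichoose f j))) ⟩
  [ j ≤ᵇ a ] * chain (suc r) h (a ∸ j) (λ f → multichoose f j) ∎
  where
  open ≡-Reasoning
  summand : ℕ → ℕ
  summand f = [ f ≤ᵇ a ∸ j ] * ((h C f) * chain r f (a ∸ j ∸ f) (λ f → multichoose f j))
  regroup : ∀ c p q x → c * (p * (q * x)) ≡ (p * q) * (c * x)
  regroup = solve-∀
  term : ∀ f → (h C f) * mulX^ f (power (run r) f) a j ≡ [ j ≤ᵇ a ] * summand f
  term f = begin
    (h C f) * mulX^ f (power (run r) f) a j
      ≡⟨ cong ((h C f) *_) (mulX^-apply f (power (run r) f) a j) ⟩
    (h C f) * ([ f ≤ᵇ a ] * power (run r) f (a ∸ f) j)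
      ≡⟨ cong (λ t → (h C f) * ([ f ≤ᵇ a ] * t)) (power-run-chain r f (a ∸ f) j) ⟩
    (h C f) * ([ f ≤ᵇ a ] * ([ j ≤ᵇ a ∸ f ] * chain r f (a ∸ f ∸ j) (λ f → multichoose f j)))
      ≡⟨ regroup (h C f) [ f ≤ᵇ a ] _ _ ⟩
    ([ f ≤ᵇ a ] * [ j ≤ᵇ a ∸ f ]) * ((h C f) * chain r f (a ∸ f ∸ j) (λ f → multichoose f j))
      ≡⟨ cong₂ (λ u v → u * ((h C f) * chain r f v (λ f → multichoose f j))) ([≤ᵇ]-∸-comm f j a) (∸-∸-comm a f j) ⟩
    ([ j ≤ᵇ a ] * [ f ≤ᵇ a ∸ j ]) * ((h C f) * chain r f (a ∸ j ∸ f) (λ f → multichoose f j))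
      ≡⟨ *-assoc [ j ≤ᵇ a ] _ _ ⟩
    [ j ≤ᵇ a ] * summand f ∎

chain-cong : ∀ r p t {u v : ℕ → ℕ} → (∀ f → u f ≡ v f) → chain r p t u ≡ chain r p t v
chain-cong zero p t e = cong (λ x → if t ≡ᵇ 0 then x else 0) (e p)
chain-cong (suc r) p t {u} {v} e = begin
  chain (suc r) p t u                                              ≡⟨ chain-suc r p t u ⟩
  ∑ℕ[ f < suc p ] ([ f ≤ᵇ t ] * ((p C f) * chain r f (t ∸ f) u))   ≡⟨ ∑ℕ-cong (suc p) (λ f →
                                                                        cong (λ x → [ f ≤ᵇ t ] * ((p C f) * x)) (chain-cong r f (t ∸ f) e)) ⟩
  ∑ℕ[ f < suc p ] ([ f ≤ᵇ t ] * ((p C f) * chain r f (t ∸ f) v))   ≡⟨ sym (chain-suc r p t v) ⟩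
  chain (suc r) p t v                                              ∎
  where open ≡-Reasoning

chain-∑ℕ : ∀ r p t K (c : ℕ → ℕ) (W : ℕ → ℕ → ℕ) →
  chain r p t (λ f → ∑ℕ[ k < K ] (c k * W k f)) ≡ ∑ℕ[ k < K ] (c k * chain r p t (W k))
chain-∑ℕ zero p t K c W with t ≡ᵇ 0
... | true = refl
... | false = sym (∑ℕ-zero K λ k → *-zeroʳ (c k))
chain-∑ℕ (suc r) p t K c W = begin
  chain (suc r) p t (λ f → ∑ℕ[ k < K ] (c k * W k f))
    ≡⟨ chain-suc r p t _ ⟩
  ∑ℕ[ f < suc p ] ([ f ≤ᵇ t ] * ((p C f) * chain r f (t ∸ f) (λ f → ∑ℕ[ k < K ] (c k * W k f))))
    ≡⟨ ∑ℕ-cong (suc p) (λ f → cong (λ x → [ f ≤ᵇ t ] * ((p C f) * x)) (chain-∑ℕ r f (t ∸ f) K c W)) ⟩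
  ∑ℕ[ f < suc p ] ([ f ≤ᵇ t ] * ((p C f) * ∑ℕ[ k < K ] (c k * chain r f (t ∸ f) (W k))))
    ≡⟨ ∑ℕ-cong (suc p) (λ f → trans (cong ([ f ≤ᵇ t ] *_) (*-distribˡ-∑ℕ-weighted K (p C f) c (λ k → chain r f (t ∸ f) (W k))))
                                       (*-distribˡ-∑ℕ-weighted K [ f ≤ᵇ t ] c (λ k → (p C f) * chain r f (t ∸ f) (W k)))) ⟩
  ∑ℕ[ f < suc p ] ∑ℕ[ k < K ] (c k * term k f)
    ≡⟨ ∑ℕ-comm (suc p) K (λ f k → c k * term k f) ⟩
  ∑ℕ[ k < K ] ∑ℕ[ f < suc p ] (c k * term k f)
    ≡⟨ ∑ℕ-cong K (λ k → trans (sym (*-distribˡ-∑ℕ (suc p) (c k) (term k)))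
                              (cong (c k *_) (sym (chain-suc r p t (W k))))) ⟩
  ∑ℕ[ k < K ] (c k * chain (suc r) p t (W k)) ∎
  where
  open ≡-Reasoning
  term : ℕ → ℕ → ℕ
  term k f = [ f ≤ᵇ t ] * ((p C f) * chain r f (t ∸ f) (W k))

chain-*ˡ : ∀ r p t a (u : ℕ → ℕ) → chain r p t (λ f → a * u f) ≡ a * chain r p t u
chain-*ˡ r p t a u = begin
  chain r p t (λ f → a * u f)              ≡⟨ chain-cong r p t (λ f → sym (+-identityʳ (a * u f))) ⟩
  chain r p t (λ f → ∑ℕ[ _ < 1 ] (a * u f)) ≡⟨ chain-∑ℕ r p t 1 (λ _ → a) (λ _ → u) ⟩
  a * chain r p t u + 0                    ≡⟨ +-identityʳ _ ⟩
  a * chain r p t u                        ∎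
  where open ≡-Reasoning

coeffC-closed : ∀ s m g h → coeffC s m g h ≡ [ h + g ≤ᵇ m ] * chain s h (m ∸ h ∸ g) (λ f → multichoose f g)
coeffC-closed s m zero h rewrite +-identityʳ h = if-then-else-0 (h ≤ᵇ m) _
coeffC-closed s m (suc g) h = begin
  (if b then N else 0) / suc g        ≡⟨ cong (λ x → (if b then x else 0) / suc g) numerator ⟩
  (if b then suc g * X else 0) / suc g ≡⟨ cong (_/ suc g) (trans (if-then-else-0 b _) (x∙yz≈y∙xz [ b ] (suc g) X)) ⟩
  suc g * ([ b ] * X) / suc g         ≡⟨ cong (_/ suc g) (*-comm (suc g) ([ b ] * X)) ⟩
  [ b ] * X * suc g / suc g           ≡⟨ m*n/n≡m ([ b ] * X) (suc g) ⟩
  [ b ] * X                           ∎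
  where
  open ≡-Reasoning
  b = h + suc g ≤ᵇ m
  t = m ∸ h ∸ suc g
  X = chain s h t (λ f → multichoose f (suc g))
  N = sumFromTo 1 (suc g) (λ k → k * chain s h t (λ f → (f C k) * (suc g C k)))
  numerator : N ≡ suc g * X
  numerator = begin
    N
      ≡⟨ sumFromTo-∑ℕ _ 1 (suc g) ⟩
    ∑ℕ[ k < suc g ] (suc k * chain s h t (λ f → (f C suc k) * (suc g C suc k)))
      ≡⟨ sym (chain-∑ℕ s h t (suc g) suc (λ k f → (f C suc k) * (suc g C suc k))) ⟩
    chain s h t (λ f → ∑ℕ[ k < suc g ] (suc k * ((f C suc k) * (suc g C suc k))))
      ≡⟨ chain-cong s h t (λ f → ∑-weighted-vandermonde f g) ⟩
    chain s h t (λ f → suc g * multichoose f (suc g))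
      ≡⟨ chain-*ˡ s h t (suc g) (λ f → multichoose f (suc g)) ⟩
    suc g * X ∎

coeffC-power-run : ∀ s m g h → coeffC s m g h ≡ mulX^ h (power (run s) h) m g
coeffC-power-run s m g h = sym (begin
  mulX^ h (power (run s) h) m g
    ≡⟨ mulX^-apply h (power (run s) h) m g ⟩
  [ h ≤ᵇ m ] * power (run s) h (m ∸ h) g
    ≡⟨ cong ([ h ≤ᵇ m ] *_) (power-run-chain s h (m ∸ h) g) ⟩
  [ h ≤ᵇ m ] * ([ g ≤ᵇ m ∸ h ] * chain s h (m ∸ h ∸ g) (λ f → multichoose f g))
    ≡⟨ sym (*-assoc [ h ≤ᵇ m ] _ _) ⟩
  [ h ≤ᵇ m ] * [ g ≤ᵇ m ∸ h ] * chain s h (m ∸ h ∸ g) (λ f → multichoose f g)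
    ≡⟨ cong (_* chain s h (m ∸ h ∸ g) (λ f → multichoose f g)) (trans (sym ([]-∧ (h ≤ᵇ m) _)) (cong [_] (≤ᵇ-∧-∸ h g m))) ⟩
  [ h + g ≤ᵇ m ] * chain s h (m ∸ h ∸ g) (λ f → multichoose f g)
    ≡⟨ sym (coeffC-closed s m g h) ⟩
  coeffC s m g h ∎)
  where open ≡-Reasoning

-- Binary words

∑Words : ℕ → (List Bool → ℕ) → ℕ
∑Words zero f = f []
∑Words (suc N) f = ∑Words N (f ∘ (false ∷_)) + ∑Words N (f ∘ (true ∷_))

∑Words-cong : ∀ N {f g : List Bool → ℕ} → (∀ ys → length ys ≡ N → f ys ≡ g ys) → ∑Words N f ≡ ∑Words N g
∑Words-cong zero e = e [] refl
∑Words-cong (suc N) e =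
  cong₂ _+_ (∑Words-cong N λ ys l → e (false ∷ ys) (cong suc l)) (∑Words-cong N λ ys l → e (true ∷ ys) (cong suc l))

∑Words-zero : ∀ N {f : List Bool → ℕ} → (∀ ys → length ys ≡ N → f ys ≡ 0) → ∑Words N f ≡ 0
∑Words-zero zero e = e [] refl
∑Words-zero (suc N) e =
  cong₂ _+_ (∑Words-zero N λ ys l → e (false ∷ ys) (cong suc l)) (∑Words-zero N λ ys l → e (true ∷ ys) (cong suc l))

*-distribˡ-∑Words : ∀ N c (f : List Bool → ℕ) → c * ∑Words N f ≡ ∑Words N (λ ys → c * f ys)
*-distribˡ-∑Words zero c f = refl
*-distribˡ-∑Words (suc N) c f =
  trans (*-distribˡ-+ c _ _) (cong₂ _+_ (*-distribˡ-∑Words N c (f ∘ (false ∷_))) (*-distribˡ-∑Words N c (f ∘ (true ∷_))))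

∑Words-∑ℕ : ∀ N K (G : ℕ → List Bool → ℕ) → ∑Words N (λ ys → ∑ℕ[ i < K ] G i ys) ≡ ∑ℕ[ i < K ] ∑Words N (G i)
∑Words-∑ℕ zero K G = refl
∑Words-∑ℕ (suc N) K G = trans
  (cong₂ _+_ (∑Words-∑ℕ N K λ i → G i ∘ (false ∷_)) (∑Words-∑ℕ N K λ i → G i ∘ (true ∷_)))
  (sym (∑ℕ-+ K (λ i → ∑Words N (G i ∘ (false ∷_))) (λ i → ∑Words N (G i ∘ (true ∷_)))))

∑Words-snoc : ∀ N (f : List Bool → ℕ) →
  ∑Words (suc N) f ≡ ∑Words N (λ w → f (w ++ false ∷ [])) + ∑Words N (λ w → f (w ++ true ∷ []))
∑Words-snoc zero f = refl
∑Words-snoc (suc N) f = trans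
  (cong₂ _+_ (∑Words-snoc N (f ∘ (false ∷_))) (∑Words-snoc N (f ∘ (true ∷_))))
  (+-comm-middle (∑Words N (λ w → f (false ∷ w ++ false ∷ []))) (∑Words N (λ w → f (false ∷ w ++ true ∷ [])))
                 (∑Words N (λ w → f (true ∷ w ++ false ∷ []))) (∑Words N (λ w → f (true ∷ w ++ true ∷ []))))
  where
  +-comm-middle : ∀ a b c d → (a + b) + (c + d) ≡ (a + c) + (b + d)
  +-comm-middle = solve-∀

length-filterᵇ : ∀ {A : Set} (p : A → Bool) xs → length (filterᵇ p xs) ≡ sumᴸ (map ([_] ∘ p) xs)
length-filterᵇ p [] = refl
length-filterᵇ p (x ∷ xs) with p x
... | true = cong suc (length-filterᵇ p xs)
... | false = length-filterᵇ p xs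

sum-map-concatMap-pair : ∀ {A B : Set} (f : B → ℕ) (u v : A → B) xs →
  sumᴸ (map f (concatMap (λ x → u x ∷ v x ∷ []) xs)) ≡ sumᴸ (map (f ∘ u) xs) + sumᴸ (map (f ∘ v) xs)
sum-map-concatMap-pair f u v [] = refl
sum-map-concatMap-pair f u v (x ∷ xs) =
  trans (cong (λ t → f (u x) + (f (v x) + t)) (sum-map-concatMap-pair f u v xs)) (shuffle (f (u x)) (f (v x)) _ _)
  where
  shuffle : ∀ a b c d → a + (b + (c + d)) ≡ (a + c) + (b + d)
  shuffle = solve-∀

sum-map-allWords : ∀ N (F : List Bool → ℕ) → sumᴸ (map (F ∘ toList) (allWords N)) ≡ ∑Words N F
sum-map-allWords zero F = +-identityʳ (F [])
sum-map-allWords (suc N) F = trans (sum-map-concatMap-pair (F ∘ toList) (false ∷ᵥ_) (true ∷ᵥ_) (allWords N))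
  (cong₂ _+_ (sum-map-allWords N (F ∘ (false ∷_))) (sum-map-allWords N (F ∘ (true ∷_))))

hasProfile : ℕ → ℕ → ℕ → List Bool → List Bool → Bool
hasProfile m n g U ys = (countB false ys ≡ᵇ m) ∧ ((countB true ys ≡ᵇ n) ∧ (cycOcc U ys ≡ᵇ g))

Tcount-∑Words : ∀ m n g U → Tcount m n g U ≡ ∑Words (m + n) (λ ys → [ hasProfile m n g U ys ])
Tcount-∑Words m n g U = trans (length-filterᵇ _ (allWords (m + n))) (sum-map-allWords (m + n) _)

countB-∷ : ∀ b x xs → countB b (x ∷ xs) ≡ [ bitEq b x ] + countB b xs
countB-∷ b x xs with bitEq b x
... | true = refl
... | false = refl

countB-≤-length : ∀ b ys → countB b ys ≤ length ys
countB-≤-length b = length-filter (T? ∘ bitEq b)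

countB-++ : ∀ b xs ys → countB b (xs ++ ys) ≡ countB b xs + countB b ys
countB-++ b xs ys = trans (cong length (filter-++ (T? ∘ bitEq b) xs ys)) (length-++ (filterᵇ (bitEq b) xs))

countB-false+true : ∀ ys → countB false ys + countB true ys ≡ length ys
countB-false+true [] = refl
countB-false+true (false ∷ ys) = cong suc (countB-false+true ys)
countB-false+true (true ∷ ys) = trans (+-suc (countB false ys) _) (cong suc (countB-false+true ys))

rotate : List Bool → List Bool
rotate [] = []
rotate (x ∷ xs) = xs ++ x ∷ []

rotate^ : ℕ → List Bool → List Bool
rotate^ zero ys = ys
rotate^ (suc i) ys = rotate^ i (rotate ys)

length-rotate : ∀ ys → length (rotate ys) ≡ length ys
length-rotate [] = refl
length-rotate (x ∷ xs) = trans (length-++ xs) (+-comm (length xs) 1)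

∑Words-rotate^ : ∀ i N (f : List Bool → ℕ) → ∑Words N (f ∘ rotate^ i) ≡ ∑Words N f
∑Words-rotate^ zero N f = refl
∑Words-rotate^ (suc i) zero f = ∑Words-rotate^ i zero f
∑Words-rotate^ (suc i) (suc N) f = trans (sym (∑Words-snoc N (f ∘ rotate^ i))) (∑Words-rotate^ i (suc N) f)

countB-rotate : ∀ b ys → countB b (rotate ys) ≡ countB b ys
countB-rotate b [] = refl
countB-rotate b (x ∷ xs) =
  trans (countB-++ b xs (x ∷ [])) (trans (+-comm (countB b xs) _) (sym (countB-++ b (x ∷ []) xs)))

leadingOne : List Bool → ℕ
leadingOne [] = 0
leadingOne (x ∷ _) = [ x ]

∑-leadingOne-rotate^ : ∀ xs t → ∑ℕ[ i < length xs ] leadingOne (rotate^ i (xs ++ t)) ≡ countB true xs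
∑-leadingOne-rotate^ [] t = refl
∑-leadingOne-rotate^ (x ∷ xs) t = begin
  [ x ] + ∑ℕ[ i < length xs ] leadingOne (rotate^ i ((xs ++ t) ++ x ∷ []))
    ≡⟨ cong ([ x ] +_) (∑ℕ-cong (length xs) λ i → cong (leadingOne ∘ rotate^ i) (++-assoc xs t (x ∷ []))) ⟩
  [ x ] + ∑ℕ[ i < length xs ] leadingOne (rotate^ i (xs ++ t ++ x ∷ []))
    ≡⟨ cong₂ _+_ (bitEq-true x) (∑-leadingOne-rotate^ xs (t ++ x ∷ [])) ⟩
  [ bitEq true x ] + countB true xs
    ≡⟨ sym (countB-∷ true x xs) ⟩
  countB true (x ∷ xs) ∎
  where
  open ≡-Reasoning
  bitEq-true : ∀ x → [ x ] ≡ [ bitEq true x ]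
  bitEq-true true = refl
  bitEq-true false = refl

countB-true-rotate^ : ∀ N ys → length ys ≡ N → countB true ys ≡ ∑ℕ[ i < N ] leadingOne (rotate^ i ys)
countB-true-rotate^ N ys refl = sym (begin
  ∑ℕ[ i < length ys ] leadingOne (rotate^ i ys)          ≡⟨ ∑ℕ-cong (length ys) (λ i → cong (leadingOne ∘ rotate^ i) (sym (++-identityʳ ys))) ⟩
  ∑ℕ[ i < length ys ] leadingOne (rotate^ i (ys ++ []))  ≡⟨ ∑-leadingOne-rotate^ ys [] ⟩
  countB true ys                                         ∎)
  where open ≡-Reasoning

-- Each of the N rotations of a word puts each of its ones in front exactly once.
∑Words-countB-true : ∀ N (φ : List Bool → ℕ) → (∀ ys → length ys ≡ N → φ (rotate ys) ≡ φ ys) →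
  ∑Words N (λ ys → countB true ys * φ ys) ≡ N * ∑Words N (λ ys → leadingOne ys * φ ys)
∑Words-countB-true N φ φ-rotate = begin
  ∑Words N (λ ys → countB true ys * φ ys)
    ≡⟨ ∑Words-cong N (λ ys l → trans (cong (_* φ ys) (countB-true-rotate^ N ys l)) (distrib ys l)) ⟩
  ∑Words N (λ ys → ∑ℕ[ i < N ] (ψ ∘ rotate^ i) ys)
    ≡⟨ ∑Words-∑ℕ N N (λ i → ψ ∘ rotate^ i) ⟩
  ∑ℕ[ i < N ] ∑Words N (ψ ∘ rotate^ i)
    ≡⟨ ∑ℕ-cong N (λ i → ∑Words-rotate^ i N ψ) ⟩
  ∑ℕ[ _ < N ] ∑Words N ψ
    ≡⟨ ∑ℕ-const N _ ⟩
  N * ∑Words N ψ ∎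
  where
  open ≡-Reasoning
  ψ : List Bool → ℕ
  ψ ys = leadingOne ys * φ ys
  φ-rotate^ : ∀ i ys → length ys ≡ N → φ (rotate^ i ys) ≡ φ ys
  φ-rotate^ zero ys l = refl
  φ-rotate^ (suc i) ys l = trans (φ-rotate^ i (rotate ys) (trans (length-rotate ys) l)) (φ-rotate ys l)
  distrib : ∀ ys → length ys ≡ N → ∑ℕ[ i < N ] leadingOne (rotate^ i ys) * φ ys ≡ ∑ℕ[ i < N ] ψ (rotate^ i ys)
  distrib ys l = trans (*-comm (∑ℕ[ i < N ] leadingOne (rotate^ i ys)) (φ ys))
    (trans (*-distribˡ-∑ℕ N (φ ys) (λ i → leadingOne (rotate^ i ys))) (∑ℕ-cong N λ i → trans (*-comm (φ ys) (leadingOne (rotate^ i ys))) (cong (leadingOne (rotate^ i ys) *_) (sym (φ-rotate^ i ys l)))))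

∑Words-leadingOne : ∀ N (φ : List Bool → ℕ) → ∑Words (suc N) (λ ys → leadingOne ys * φ ys) ≡ ∑Words N (φ ∘ (true ∷_))
∑Words-leadingOne N φ = trans (cong (_+ ∑Words N (λ w → 1 * φ (true ∷ w))) (∑Words-zero N λ _ _ → refl))
  (∑Words-cong N λ w _ → *-identityˡ (φ (true ∷ w)))

isPrefix-++ : ∀ U Z T → length U ≤ length Z → isPrefix U (Z ++ T) ≡ isPrefix U Z
isPrefix-++ [] Z T _ = refl
isPrefix-++ (u ∷ U) (z ∷ Z) T (s≤s U≤Z) = cong (bitEq u z ∧_) (isPrefix-++ U Z T U≤Z)

drop-++ˡ : ∀ {A : Set} i (Y T : List A) → i ≤ length Y → drop i (Y ++ T) ≡ drop i Y ++ T
drop-++ˡ zero Y T _ = refl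
drop-++ˡ (suc i) (y ∷ Y) T (s≤s i≤Y) = drop-++ˡ i Y T i≤Y

drop-length-++ : ∀ {A : Set} (xs T : List A) → drop (length xs) (xs ++ T) ≡ T
drop-length-++ [] T = refl
drop-length-++ (x ∷ xs) T = drop-length-++ xs T

length-drop-++ : ∀ {A : Set} i (xs T : List A) → i ≤ length xs → length T ≤ length (drop i (xs ++ T))
length-drop-++ i xs T i≤xs rewrite drop-++ˡ i xs T i≤xs | length-++ (drop i xs) {T} = m≤n+m (length T) _

occursAt : List Bool → List Bool → ℕ → ℕ
occursAt U ys i = [ isPrefix U (drop i (ys ++ ys)) ]

cycOcc-∷ : ∀ U x xs → cycOcc U (x ∷ xs) ≡ ∑ℕ[ i < suc (length xs) ] occursAt U (x ∷ xs) i
cycOcc-∷ U x xs = sumFromTo-∑ℕ (occursAt U (x ∷ xs)) 0 (length xs)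

-- Windows starting inside the rotated word see the same |U| letters as the window one step further right.
cycOcc-rotate : ∀ U ys → length U ≤ length ys → cycOcc U (rotate ys) ≡ cycOcc U ys
cycOcc-rotate U [] _ = refl
cycOcc-rotate U (x ∷ xs) U≤ys = begin
  cycOcc U (xs ++ x ∷ [])
    ≡⟨ cong (λ l → sumFromTo 0 (l ∸ 1) (occursAt U (xs ++ x ∷ []))) (length-rotate (x ∷ xs)) ⟩
  sumFromTo 0 L (occursAt U (xs ++ x ∷ []))
    ≡⟨ sumFromTo-∑ℕ (occursAt U (xs ++ x ∷ [])) 0 L ⟩
  ∑ℕ[ i < suc L ] occursAt U (xs ++ x ∷ []) i
    ≡⟨ ∑ℕ-cong-< (suc L) (λ i i<1+L → cong [_] (window i (s≤s⁻¹ i<1+L))) ⟩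
  ∑ℕ[ i < suc L ] occursAt U (x ∷ xs) (suc i)
    ≡⟨ ∑ℕ-shift-periodic (suc L) (occursAt U (x ∷ xs)) (cong [_] wrap) ⟩
  ∑ℕ[ i < suc L ] occursAt U (x ∷ xs) i
    ≡⟨ sym (cycOcc-∷ U x xs) ⟩
  cycOcc U (x ∷ xs) ∎
  where
  open ≡-Reasoning
  L = length xs
  Y = xs ++ x ∷ xs
  window : ∀ i → i ≤ L → isPrefix U (drop i ((xs ++ x ∷ []) ++ xs ++ x ∷ [])) ≡ isPrefix U (drop i Y)
  window i i≤L = begin
    isPrefix U (drop i ((xs ++ x ∷ []) ++ xs ++ x ∷ []))
      ≡⟨ cong (isPrefix U ∘ drop i) (trans (++-assoc xs _ _) (sym (++-assoc xs (x ∷ xs) (x ∷ [])))) ⟩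
    isPrefix U (drop i (Y ++ x ∷ []))
      ≡⟨ cong (isPrefix U) (drop-++ˡ i Y (x ∷ []) (≤-trans i≤L (length-++-≤ˡ xs))) ⟩
    isPrefix U (drop i Y ++ x ∷ [])
      ≡⟨ isPrefix-++ U (drop i Y) (x ∷ []) (≤-trans U≤ys (length-drop-++ i xs (x ∷ xs) i≤L)) ⟩
    isPrefix U (drop i Y) ∎
  wrap : isPrefix U (drop L Y) ≡ isPrefix U ((x ∷ xs) ++ x ∷ xs)
  wrap = trans (cong (isPrefix U) (drop-length-++ xs (x ∷ xs))) (sym (isPrefix-++ U (x ∷ xs) (x ∷ xs) U≤ys))

hasProfile-rotate : ∀ m n g U ys → length U ≤ length ys → hasProfile m n g U (rotate ys) ≡ hasProfile m n g U ys
hasProfile-rotate m n g U ys U≤ys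
  rewrite countB-rotate false ys | countB-rotate true ys | cycOcc-rotate U ys U≤ys = refl

isPrefix-zeros-sentinel : ∀ k A T T′ → isPrefix (zeros k) (A ++ true ∷ T) ≡ isPrefix (zeros k) (A ++ true ∷ T′)
isPrefix-zeros-sentinel zero A T T′ = refl
isPrefix-zeros-sentinel (suc k) [] T T′ = refl
isPrefix-zeros-sentinel (suc k) (y ∷ A) T T′ = cong (bitEq false y ∧_) (isPrefix-zeros-sentinel k A T T′)

isPrefix-zeros-run : ∀ k a T → isPrefix (zeros k) (zeros a ++ true ∷ T) ≡ (k ≤ᵇ a)
isPrefix-zeros-run zero a T = refl
isPrefix-zeros-run (suc k) zero T = refl
isPrefix-zeros-run (suc k) (suc a) T = trans (isPrefix-zeros-run k a T) (sym (≤ᵇ-suc k a))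

zeros-snoc : ∀ c (l : List Bool) → zeros c ++ false ∷ l ≡ zeros (suc c) ++ l
zeros-snoc zero l = refl
zeros-snoc (suc c) l = cong (false ∷_) (zeros-snoc c l)

∑Suffixes : (List Bool → ℕ) → List Bool → ℕ
∑Suffixes B [] = 0
∑Suffixes B (y ∷ ys) = B (y ∷ ys) + ∑Suffixes B ys

∑ℕ-drop : ∀ (B : List Bool → ℕ) w → ∑ℕ[ i < length w ] B (drop i w) ≡ ∑Suffixes B w
∑ℕ-drop B [] = refl
∑ℕ-drop B (y ∷ ys) = cong (B (y ∷ ys) +_) (∑ℕ-drop B ys)

-- Counting words by their runs of zeros

module _ (s : ℕ) where

  -- Occurrences of 0^(s+2) in the linear word 0^c ys 1: a maximal run of c zeros holds c ∸ (s+1) of them.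
  runOcc : ℕ → List Bool → ℕ
  runOcc c [] = c ∸ suc s
  runOcc c (false ∷ ys) = runOcc (suc c) ys
  runOcc c (true ∷ ys) = c ∸ suc s + runOcc 0 ys

  occursBeforeOne : List Bool → ℕ
  occursBeforeOne z = [ isPrefix (zeros (2 + s)) (z ++ true ∷ []) ]

  ∑Suffixes-zeros : ∀ c t t′ → t ++ true ∷ [] ≡ true ∷ t′ →
    ∑Suffixes occursBeforeOne (zeros c ++ t) ≡ c ∸ suc s + ∑Suffixes occursBeforeOne t
  ∑Suffixes-zeros zero t t′ _ = refl
  ∑Suffixes-zeros (suc c) t t′ t1≡1t′ = begin
    occursBeforeOne (zeros (suc c) ++ t) + ∑Suffixes occursBeforeOne (zeros c ++ t)
      ≡⟨ cong₂ _+_ (cong [_] firstWindow) (∑Suffixes-zeros c t t′ t1≡1t′) ⟩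
    [ suc s ≤ᵇ c ] + (c ∸ suc s + ∑Suffixes occursBeforeOne t)
      ≡⟨ sym (+-assoc [ suc s ≤ᵇ c ] _ _) ⟩
    [ suc s ≤ᵇ c ] + (c ∸ suc s) + ∑Suffixes occursBeforeOne t
      ≡⟨ cong (_+ ∑Suffixes occursBeforeOne t) ([≤ᵇ]+∸ s c) ⟩
    c ∸ s + ∑Suffixes occursBeforeOne t ∎
    where
    open ≡-Reasoning
    firstWindow : isPrefix (zeros (2 + s)) ((zeros (suc c) ++ t) ++ true ∷ []) ≡ (suc s ≤ᵇ c)
    firstWindow = begin
      isPrefix (zeros (2 + s)) ((zeros (suc c) ++ t) ++ true ∷ [])
        ≡⟨ cong (isPrefix (zeros (2 + s))) (trans (++-assoc (zeros (suc c)) t _) (cong (zeros (suc c) ++_) t1≡1t′)) ⟩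
      isPrefix (zeros (2 + s)) (zeros (suc c) ++ true ∷ t′)
        ≡⟨ isPrefix-zeros-run (2 + s) (suc c) t′ ⟩
      (2 + s ≤ᵇ suc c)
        ≡⟨ ≤ᵇ-suc (suc s) c ⟩
      (suc s ≤ᵇ c) ∎

  ∑Suffixes-runOcc : ∀ c ys → ∑Suffixes occursBeforeOne (zeros c ++ ys) ≡ runOcc c ys
  ∑Suffixes-runOcc c [] = trans (∑Suffixes-zeros c [] [] refl) (+-identityʳ _)
  ∑Suffixes-runOcc c (false ∷ ys) = trans (cong (∑Suffixes occursBeforeOne) (zeros-snoc c ys)) (∑Suffixes-runOcc (suc c) ys)
  ∑Suffixes-runOcc c (true ∷ ys) =
    trans (∑Suffixes-zeros c (true ∷ ys) (ys ++ true ∷ []) refl) (cong (c ∸ suc s +_) (∑Suffixes-runOcc 0 ys))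

  -- The leading one cuts the cyclic word open without splitting a run of zeros.
  cycOcc-true∷ : ∀ w → cycOcc (zeros (2 + s)) (true ∷ w) ≡ runOcc 0 w
  cycOcc-true∷ w = begin
    cycOcc (zeros (2 + s)) (true ∷ w)
      ≡⟨ cycOcc-∷ (zeros (2 + s)) true w ⟩
    ∑ℕ[ i < length w ] [ isPrefix (zeros (2 + s)) (drop i (w ++ true ∷ w)) ]
      ≡⟨ ∑ℕ-cong-< (length w) (λ i i<w → cong [_] (trans
           (cong (isPrefix (zeros (2 + s))) (drop-++ˡ i w (true ∷ w) (<⇒≤ i<w)))
           (isPrefix-zeros-sentinel (2 + s) (drop i w) w []))) ⟩
    ∑ℕ[ i < length w ] occursBeforeOne (drop i w)
      ≡⟨ ∑ℕ-drop occursBeforeOne w ⟩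
    ∑Suffixes occursBeforeOne w
      ≡⟨ ∑Suffixes-runOcc 0 w ⟩
    runOcc 0 w ∎
    where open ≡-Reasoning

  -- The series of a run of zeros of which c have already been read.
  openRun : ℕ → Series
  openRun c a = run (suc s) (c + a)

  ⋆-openRun : ∀ c H a j →
    (openRun c ⋆ H) a j ≡ [ c ∸ suc s ≤ᵇ j ] * H a (j ∸ (c ∸ suc s)) + mulX (openRun (suc c) ⋆ H) a j
  ⋆-openRun c H a j = cong₂ _+_ firstRow (laterRows a)
    where
    firstRow : ∑ℕ[ k < suc j ] (openRun c 0 k * H a (j ∸ k)) ≡ [ c ∸ suc s ≤ᵇ j ] * H a (j ∸ (c ∸ suc s))
    firstRow = trans (∑ℕ-cong (suc j) λ k → cong (λ z → [ k ≡ᵇ z ∸ suc s ] * H a (j ∸ k)) (+-identityʳ c))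
                     (∑ℕ-[≡ᵇ] j (c ∸ suc s) (λ k → H a (j ∸ k)))
    laterRows : ∀ a → ∑ℕ[ i < a ] ∑ℕ[ k < suc j ] (openRun c (suc i) k * H (a ∸ suc i) (j ∸ k)) ≡ mulX (openRun (suc c) ⋆ H) a j
    laterRows zero = refl
    laterRows (suc a) = ⋆-congʳ H (λ i k → cong (λ z → [ k ≡ᵇ z ∸ suc s ]) (+-suc c i)) a j

  ∑Words-runOcc : ∀ N c m n g → N ≡ m + n →
    ∑Words N (λ ys → [ countB false ys ≡ᵇ m ] * [ runOcc c ys ≡ᵇ g ]) ≡ (openRun c ⋆ power (run (suc s)) n) m g
  ∑Words-runOcc zero c zero zero g _ = begin
    1 * [ c ∸ suc s ≡ᵇ g ]                                     ≡⟨ *-identityˡ _ ⟩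
    [ c ∸ suc s ≡ᵇ g ]                                         ≡⟨ [≡ᵇ]-𝟙 (c ∸ suc s) g ⟩
    [ c ∸ suc s ≤ᵇ g ] * 𝟙 0 (g ∸ (c ∸ suc s))                 ≡⟨ sym (+-identityʳ _) ⟩
    [ c ∸ suc s ≤ᵇ g ] * 𝟙 0 (g ∸ (c ∸ suc s)) + 0             ≡⟨ sym (⋆-openRun c 𝟙 0 g) ⟩
    (openRun c ⋆ 𝟙) 0 g                                        ∎
    where open ≡-Reasoning
  ∑Words-runOcc (suc N) c m n g N+1≡m+n = begin
    ∑Words N (λ w → [ suc (countB false w) ≡ᵇ m ] * [ runOcc (suc c) w ≡ᵇ g ])
      + ∑Words N (λ w → [ countB false w ≡ᵇ m ] * [ e + runOcc 0 w ≡ᵇ g ])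
      ≡⟨ cong₂ _+_ (afterZero m N+1≡m+n) afterOne ⟩
    mulX (openRun (suc c) ⋆ H) m g + [ e ≤ᵇ g ] * H m (g ∸ e)
      ≡⟨ +-comm (mulX (openRun (suc c) ⋆ H) m g) _ ⟩
    [ e ≤ᵇ g ] * H m (g ∸ e) + mulX (openRun (suc c) ⋆ H) m g
      ≡⟨ sym (⋆-openRun c H m g) ⟩
    (openRun c ⋆ H) m g ∎
    where
    open ≡-Reasoning
    H = power (run (suc s)) n
    e = c ∸ suc s
    afterZero : ∀ m → suc N ≡ m + n →
      ∑Words N (λ w → [ suc (countB false w) ≡ᵇ m ] * [ runOcc (suc c) w ≡ᵇ g ]) ≡ mulX (openRun (suc c) ⋆ H) m g
    afterZero zero _ = ∑Words-zero N λ _ _ → refl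
    afterZero (suc m) eq = ∑Words-runOcc N (suc c) m n g (suc-injective eq)
    restart : ∀ m n → suc N ≡ m + n →
      ∑Words N (λ w → [ countB false w ≡ᵇ m ] * [ runOcc 0 w ≡ᵇ g ∸ e ]) ≡ power (run (suc s)) n m (g ∸ e)
    restart m (suc n) eq = ∑Words-runOcc N 0 m n (g ∸ e) (suc-injective (trans eq (+-suc m n)))
    restart (suc m) zero eq = ∑Words-zero N λ w l → cong (λ b → [ b ] * [ runOcc 0 w ≡ᵇ g ∸ e ])
      (dec-false (countB false w ≟ suc m) λ #0≡1+m → 1+n≰n (subst (_≤ m) #0≡1+m
        (≤-trans (countB-≤-length false w) (≤-reflexive (trans l (suc-injective (trans eq (+-identityʳ (suc m)))))))))
    afterOne : ∑Words N (λ w → [ countB false w ≡ᵇ m ] * [ e + runOcc 0 w ≡ᵇ g ]) ≡ [ e ≤ᵇ g ] * H m (g ∸ e)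
    afterOne = begin
      ∑Words N (λ w → [ countB false w ≡ᵇ m ] * [ e + runOcc 0 w ≡ᵇ g ])
        ≡⟨ ∑Words-cong N (λ w _ → trans (cong ([ countB false w ≡ᵇ m ] *_) ([+≡ᵇ] e (runOcc 0 w) g))
                                        (x∙yz≈y∙xz [ countB false w ≡ᵇ m ] [ e ≤ᵇ g ] _)) ⟩
      ∑Words N (λ w → [ e ≤ᵇ g ] * ([ countB false w ≡ᵇ m ] * [ runOcc 0 w ≡ᵇ g ∸ e ]))
        ≡⟨ sym (*-distribˡ-∑Words N [ e ≤ᵇ g ] _) ⟩
      [ e ≤ᵇ g ] * ∑Words N (λ w → [ countB false w ≡ᵇ m ] * [ runOcc 0 w ≡ᵇ g ∸ e ])
        ≡⟨ cong ([ e ≤ᵇ g ] *_) (restart m n N+1≡m+n) ⟩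
      [ e ≤ᵇ g ] * H m (g ∸ e) ∎

  hasProfile-true∷ : ∀ m n g w → length w ≡ m + n →
    [ hasProfile m (suc n) g (zeros (2 + s)) (true ∷ w) ] ≡ [ countB false w ≡ᵇ m ] * [ runOcc 0 w ≡ᵇ g ]
  hasProfile-true∷ m n g w w≡m+n =
    trans ([∧-implied] (countB false w ≡ᵇ m) _ _ ones≡n)
          (cong (λ k → [ countB false w ≡ᵇ m ] * [ k ≡ᵇ g ]) (cycOcc-true∷ w))
    where
    ones≡n : (countB false w ≡ᵇ m) ≡ true → (countB true w ≡ᵇ n) ≡ true
    ones≡n zeros≡m = dec-true (countB true w ≟ n) (+-cancelˡ-≡ m _ _ (begin
      m + countB true w                ≡⟨ cong (_+ countB true w) (sym (≡ᵇ⇒≡ _ m (Equivalence.from T-≡ zeros≡m))) ⟩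
      countB false w + countB true w   ≡⟨ countB-false+true w ⟩
      length w                         ≡⟨ w≡m+n ⟩
      m + n                            ∎))
      where open ≡-Reasoning

  ∑-binomial-coeffC : ∀ m n g → 1 ≤ m →
    ∑ℕ[ h < suc n ] ((n C h) * mulX^ h (power (run s) h) m g) ≡ sumFromTo 1 (m ⊓ n) (λ h → coeffC s m g h * (n C h))
  ∑-binomial-coeffC m@(suc _) n g _ = begin
    ∑ℕ[ h < n ] G h                                   ≡⟨ ∑ℕ-truncate (m ⊓ n) n G (m⊓n≤n m n) vanish ⟩
    ∑ℕ[ h < m ⊓ n ] G h                               ≡⟨ ∑ℕ-cong (m ⊓ n) (λ h → trans (*-comm (n C suc h) (mulX^ (suc h) (power (run s) (suc h)) m g))
                                                            (cong (_* (n C suc h)) (sym (coeffC-power-run s m g (suc h))))) ⟩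
    ∑ℕ[ h < m ⊓ n ] (coeffC s m g (suc h) * (n C suc h)) ≡⟨ sym (sumFromTo-∑ℕ (λ h → coeffC s m g h * (n C h)) 1 (m ⊓ n)) ⟩
    sumFromTo 1 (m ⊓ n) (λ h → coeffC s m g h * (n C h)) ∎
    where
    open ≡-Reasoning
    G : ℕ → ℕ
    G h = (n C suc h) * mulX^ (suc h) (power (run s) (suc h)) m g
    vanish : ∀ i → m ⊓ n ≤ i → i < n → G i ≡ 0
    vanish i m⊓n≤i i<n = begin
      (n C suc i) * mulX^ (suc i) (power (run s) (suc i)) m g
        ≡⟨ cong ((n C suc i) *_) (mulX^-apply (suc i) (power (run s) (suc i)) m g) ⟩
      (n C suc i) * ([ suc i ≤ᵇ m ] * power (run s) (suc i) (m ∸ suc i) g)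
        ≡⟨ cong (λ b → (n C suc i) * ([ b ] * power (run s) (suc i) (m ∸ suc i) g))
                (dec-false (suc i ≤? m) (≤⇒≯ (⊓-≤-<⇒≤ m n i m⊓n≤i i<n))) ⟩
      (n C suc i) * 0
        ≡⟨ *-zeroʳ (n C suc i) ⟩
      0 ∎

  Tcount-zeros-formula : ∀ m n g → 1 ≤ m → 1 ≤ n → 2 + s < m + n →
    n * Tcount m n g (zeros (2 + s)) ≡ (m + n) * sumFromTo 1 (m ⊓ n) (λ h → coeffC s m g h * (n C h))
  Tcount-zeros-formula m@(suc _) n@(suc n′) g _ _ 2+s<N = begin
    n * Tcount m n g Z                                  ≡⟨ cong (n *_) (Tcount-∑Words m n g Z) ⟩
    n * ∑Words N (λ ys → [ P ys ])                      ≡⟨ *-distribˡ-∑Words N n (λ ys → [ P ys ]) ⟩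
    ∑Words N (λ ys → n * [ P ys ])                      ≡⟨ ∑Words-cong N (λ ys _ → *-[∧≡ᵇ∧] (countB false ys ≡ᵇ m) (countB true ys) n (cycOcc Z ys ≡ᵇ g)) ⟩
    ∑Words N (λ ys → countB true ys * [ P ys ])         ≡⟨ ∑Words-countB-true N (λ ys → [ P ys ]) P-rotate ⟩
    N * ∑Words N (λ ys → leadingOne ys * [ P ys ])      ≡⟨ cong (λ k → N * ∑Words k (λ ys → leadingOne ys * [ P ys ])) (+-suc m n′) ⟩
    N * ∑Words (suc N′) (λ ys → leadingOne ys * [ P ys ]) ≡⟨ cong (N *_) (∑Words-leadingOne N′ (λ ys → [ P ys ])) ⟩
    N * ∑Words N′ (λ w → [ P (true ∷ w) ])              ≡⟨ cong (N *_) (∑Words-cong N′ (hasProfile-true∷ m n′ g)) ⟩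
    N * ∑Words N′ (λ w → [ countB false w ≡ᵇ m ] * [ runOcc 0 w ≡ᵇ g ])
                                                        ≡⟨ cong (N *_) (∑Words-runOcc N′ 0 m n′ g refl) ⟩
    N * power (run (suc s)) n m g                       ≡⟨ cong (N *_) (power-run-binomial s n m g) ⟩
    N * ∑ℕ[ h < suc n ] ((n C h) * mulX^ h (power (run s) h) m g)
                                                        ≡⟨ cong (N *_) (∑-binomial-coeffC m n g (s≤s z≤n)) ⟩
    N * sumFromTo 1 (m ⊓ n) (λ h → coeffC s m g h * (n C h)) ∎
    where
    open ≡-Reasoning
    N = m + n
    N′ = m + n′
    Z = zeros (2 + s)
    P = hasProfile m n g Z
    P-rotate : ∀ ys → length ys ≡ N → [ P (rotate ys) ] ≡ [ P ys ]
    P-rotate ys l = cong [_] (hasProfile-rotate m n g Z ys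
      (subst₂ _≤_ (sym (length-replicate (2 + s))) (sym l) (<⇒≤ 2+s<N)))

-- Complementing letters

∑Words-map-not : ∀ N (f : List Bool → ℕ) → ∑Words N (f ∘ map not) ≡ ∑Words N f
∑Words-map-not zero f = refl
∑Words-map-not (suc N) f = trans (cong₂ _+_ (∑Words-map-not N (f ∘ (true ∷_))) (∑Words-map-not N (f ∘ (false ∷_))))
  (+-comm (∑Words N (f ∘ (true ∷_))) _)

bitEq-not : ∀ b y → bitEq b (not y) ≡ bitEq (not b) y
bitEq-not true true = refl
bitEq-not true false = refl
bitEq-not false true = refl
bitEq-not false false = refl

countB-map-not : ∀ b ys → countB b (map not ys) ≡ countB (not b) ys
countB-map-not b [] = refl
countB-map-not b (y ∷ ys) = begin
  countB b (not y ∷ map not ys)              ≡⟨ countB-∷ b (not y) (map not ys) ⟩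
  [ bitEq b (not y) ] + countB b (map not ys) ≡⟨ cong₂ _+_ (cong [_] (bitEq-not b y)) (countB-map-not b ys) ⟩
  [ bitEq (not b) y ] + countB (not b) ys     ≡⟨ sym (countB-∷ (not b) y ys) ⟩
  countB (not b) (y ∷ ys)                    ∎
  where open ≡-Reasoning

isPrefix-map-not : ∀ U l → isPrefix (map not U) (map not l) ≡ isPrefix U l
isPrefix-map-not [] l = refl
isPrefix-map-not (u ∷ U) [] = refl
isPrefix-map-not (u ∷ U) (x ∷ l) =
  cong₂ _∧_ (trans (bitEq-not (not u) x) (cong (λ b → bitEq b x) (not-involutive u))) (isPrefix-map-not U l)

cycOcc-map-not : ∀ U ys → cycOcc (map not U) (map not ys) ≡ cycOcc U ys
cycOcc-map-not U ys = begin
  cycOcc (map not U) (map not ys)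
    ≡⟨ sumFromTo-∑ℕ (occursAt (map not U) (map not ys)) 0 (length (map not ys) ∸ 1) ⟩
  ∑ℕ[ i < suc (length (map not ys) ∸ 1) ] occursAt (map not U) (map not ys) i
    ≡⟨ cong (λ l → ∑ℕ[ i < suc (l ∸ 1) ] occursAt (map not U) (map not ys) i) (length-map not ys) ⟩
  ∑ℕ[ i < suc (length ys ∸ 1) ] occursAt (map not U) (map not ys) i
    ≡⟨ ∑ℕ-cong (suc (length ys ∸ 1)) (λ i → cong [_] (begin
         isPrefix (map not U) (drop i (map not ys ++ map not ys))   ≡⟨ cong (isPrefix (map not U) ∘ drop i) (sym (map-++ not ys ys)) ⟩
         isPrefix (map not U) (drop i (map not (ys ++ ys)))         ≡⟨ cong (isPrefix (map not U)) (drop-map i (ys ++ ys)) ⟩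
         isPrefix (map not U) (map not (drop i (ys ++ ys)))         ≡⟨ isPrefix-map-not U (drop i (ys ++ ys)) ⟩
         isPrefix U (drop i (ys ++ ys))                             ∎)) ⟩
  ∑ℕ[ i < suc (length ys ∸ 1) ] occursAt U ys i
    ≡⟨ sym (sumFromTo-∑ℕ (occursAt U ys) 0 (length ys ∸ 1)) ⟩
  cycOcc U ys ∎
  where open ≡-Reasoning

∧-swapˡ : ∀ a b c → a ∧ (b ∧ c) ≡ b ∧ (a ∧ c)
∧-swapˡ true b c = refl
∧-swapˡ false true c = refl
∧-swapˡ false false c = refl

Tcount-ones≡Tcount-zeros : ∀ m n g k → Tcount m n g (ones k) ≡ Tcount n m g (zeros k)
Tcount-ones≡Tcount-zeros m n g k = begin
  Tcount m n g (ones k)                                          ≡⟨ Tcount-∑Words m n g (ones k) ⟩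
  ∑Words (m + n) (λ ys → [ hasProfile m n g (ones k) ys ])       ≡⟨ sym (∑Words-map-not (m + n) (λ ys → [ hasProfile m n g (ones k) ys ])) ⟩
  ∑Words (m + n) (λ ys → [ hasProfile m n g (ones k) (map not ys) ]) ≡⟨ ∑Words-cong (m + n) (λ ys _ → cong [_] (complement ys)) ⟩
  ∑Words (m + n) (λ ys → [ hasProfile n m g (zeros k) ys ])      ≡⟨ cong (λ N → ∑Words N (λ ys → [ hasProfile n m g (zeros k) ys ])) (+-comm m n) ⟩
  ∑Words (n + m) (λ ys → [ hasProfile n m g (zeros k) ys ])      ≡⟨ sym (Tcount-∑Words n m g (zeros k)) ⟩
  Tcount n m g (zeros k)                                         ∎
  where
  open ≡-Reasoning
  complement : ∀ ys → hasProfile m n g (ones k) (map not ys) ≡ hasProfile n m g (zeros k) ys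
  complement ys rewrite sym (map-replicate not k false) | countB-map-not false ys | countB-map-not true ys
                      | cycOcc-map-not (zeros k) ys =
    ∧-swapˡ (countB true ys ≡ᵇ m) (countB false ys ≡ᵇ n) (cycOcc (zeros k) ys ≡ᵇ g)

mainTheorem16 : (s m n g : ℕ) → 1 ≤ s → 1 ≤ m → 1 ≤ n → s + 2 < m + n →
    (n * Tcount m n g (zeros (s + 2))
       ≡ (m + n) * sumFromTo 1 (m ⊓ n) (λ h → coeffC s m g h * (n C h)))
    × (m * Tcount m n g (ones (s + 2))
       ≡ (m + n) * sumFromTo 1 (m ⊓ n) (λ h → coeffC s n g h * (m C h)))
mainTheorem16 s m n g _ 1≤m 1≤n s+2<m+n rewrite +-comm s 2 =
  Tcount-zeros-formula s m n g 1≤m 1≤n s+2<m+n ,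
  (begin
    m * Tcount m n g (ones (2 + s))    ≡⟨ cong (m *_) (Tcount-ones≡Tcount-zeros m n g (2 + s)) ⟩
    m * Tcount n m g (zeros (2 + s))   ≡⟨ Tcount-zeros-formula s n m g 1≤n 1≤m (subst (2 + s <_) (+-comm m n) s+2<m+n) ⟩
    (n + m) * sumFromTo 1 (n ⊓ m) (λ h → coeffC s n g h * (m C h))
                                       ≡⟨ cong₂ (λ N k → N * sumFromTo 1 k (λ h → coeffC s n g h * (m C h))) (+-comm n m) (⊓-comm n m) ⟩
    (m + n) * sumFromTo 1 (m ⊓ n) (λ h → coeffC s n g h * (m C h)) ∎)
  where open ≡-Reasoning
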